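{- Let $\vec{x}=[x_1,\ldots,x_d]$ be the program variables, let $\vec{a}$ be an update, and let $\phi$ be a guard, i.e. a finite conjunction (identified with a finite set) of atoms of the form $t>0$. Let $\alpha\in\{\mathit{inc},\mathit{dec},\mathit{ev}\text{ - }\mathit{dec},\mathit{ev}\text{ - }\mathit{inc}\}$ and $\xi\in\phi$, and suppose that $\neg\mathit{encode}_{\alpha,\xi}$ is unsatisfiable, where $\mathit{encode}_{\alpha,\xi}:=\mathit{encode}_\alpha(\xi,\phi\setminus\{\xi\},\vec{a})$. Let $U$ be an unsat core of $\neg\mathit{encode}_{\alpha,\xi}$ and let $\mathit{deps}_{\alpha,\xi}:=(\phi\setminus\{\xi\})\cap U$. If $\check{\phi}$ is a formula (over $\mathcal{TV}\cup\vec{x}$) such that $\check{\phi}$ implies (the conjunction of) $\mathit{deps}_{\alpha,\xi}$ for all integer instantiations of the variables, then $$\mathit{accel}_\alpha(\xi,\check{\phi},\vec{a})=\mathit{accel}_\alpha(\xi,\phi\setminus\{\xi\},\vec{a}).$$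
   Context: Variables range over $\mathbb{Z}$. $\vec{x}=[x_1,\ldots,x_d]$ are program variables and $\mathcal{TV}$ is a countably infinite set of temporary variables; $n\in\mathcal{TV}$ is a designated variable. An update $\vec{a}$ is a vector of $d$ integer-valued arithmetic expressions over $\mathcal{TV}\cup\vec{x}$. For an expression or formula $s$ and expressions $\vec{b}=[b_1,\ldots,b_d]$, $s(\vec{b})$ denotes $s$ with each $x_i$ replaced by $b_i$; $\vec{a}^0(\vec{x}):=\vec{x}$, $\vec{a}^{m+1}(\vec{x}):=\vec{a}(\vec{a}^m(\vec{x}))$, and $\xi(\vec{a})$ means $\xi(\vec{a}^1(\vec{x}))$; $\vec{a}^{n-1}(\vec{x})$ denotes a closed form parameterized by $n$. Conjunctions of atoms are identified with sets of atoms. A formula is valid if it holds for all integer instantiations of its variables. For $\xi=(t>0)$ and a formula $\check{\phi}$, define the implications $\mathit{encode}_{\mathit{inc}}(\xi,\check{\phi},\vec{a}) := (\xi\wedge\check{\phi})\Rightarrow\xi(\vec{a})$; $\mathit{encode}_{\mathit{dec}}(\xi,\check{\phi},\vec{a}) := (\xi(\vec{a})\wedge\check{\phi})\Rightarrow\xi$; $\mathit{encode}_{\mathit{ev}\text{ - }\mathit{dec}}(t>0,\check{\phi},\vec{a}) := (t\ge t(\vec{a})\wedge\check{\phi})\Rightarrow t(\vec{a})\ge t(\vec{a}^2(\vec{x}))$; $\mathit{encode}_{\mathit{ev}\text{ - }\mathit{inc}}(t>0,\check{\phi},\vec{a}) := (t\le t(\vec{a})\wedge\check{\phi})\Rightarrow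 t(\vec{a})\le t(\vec{a}^2(\vec{x}))$. The negation $\neg(P\Rightarrow Q)$ of such an implication is regarded as the conjunction of the atoms of $P$ together with the (atom) negation of $Q$. The acceleration functions are: $\mathit{accel}_{\mathit{inc}}(\xi,\check{\phi},\vec{a}):=\xi$ if $\mathit{encode}_{\mathit{inc}}(\xi,\check{\phi},\vec{a})$ is valid; $\mathit{accel}_{\mathit{dec}}(\xi,\check{\phi},\vec{a}):=\xi(\vec{a}^{n-1}(\vec{x}))$ if $\mathit{encode}_{\mathit{dec}}(\xi,\check{\phi},\vec{a})$ is valid; $\mathit{accel}_{\mathit{ev}\text{ - }\mathit{dec}}(t>0,\check{\phi},\vec{a}):=t>0\wedge t(\vec{a}^{n-1}(\vec{x}))>0$ if $\mathit{encode}_{\mathit{ev}\text{ - }\mathit{dec}}(t>0,\check{\phi},\vec{a})$ is valid; $\mathit{accel}_{\mathit{ev}\text{ - }\mathit{inc}}(t>0,\check{\phi},\vec{a}):=t>0\wedge t\le t(\vec{a})$ if $\mathit{encode}_{\mathit{ev}\text{ - }\mathit{inc}}(t>0,\check{\phi},\vec{a})$ is valid; in each case the result is $\bot$ (false) if the respective condition fails. Given a conjunction $\psi$ of atoms, an unsat core of $\psi$ is any unsatisfiable subset of $\psi$. -}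

module Defs where

open import Data.Nat using (ℕ)
open import Data.Integer using (ℤ; _+_; _*_; -_; _<_; +_)
open import Data.Fin using (Fin)
open import Data.List using (List; []; _∷_)
open import Data.List.Membership.Propositional using (_∈_)
open import Data.Product using (_×_)
open import Data.Sum using (_⊎_)
open import Data.Empty using (⊥)
open import Relation.Binary.PropositionalEquality using (_≡_; _≢_)
open import Relation.Nullary using (Dec; yes; no)

-- Integer arithmetic expressions over the program variables x_1..x_d (var i)
-- and the countably many temporary variables TV (tv k, k : ℕ).
-- The designated temporary variable n is  tv 0 .
-- 'app' allows an arbitrary binary integer operation (e.g. for closed forms).
data Expr (d : ℕ) : Set where
  var : Fin d → Expr d
  tv  : ℕ → Expr d
  con : ℤ → Expr d
  add : Expr d → Expr d → Expr d
  mul : Expr d → Expr d → Expr d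
  neg : Expr d → Expr d
  app : (ℤ → ℤ → ℤ) → Expr d → Expr d → Expr d

eval : ∀ {d} → (Fin d → ℤ) → (ℕ → ℤ) → Expr d → ℤ
eval σ τ (var i)     = σ i
eval σ τ (tv k)      = τ k
eval σ τ (con c)     = c
eval σ τ (add e f)   = eval σ τ e + eval σ τ f
eval σ τ (mul e f)   = eval σ τ e * eval σ τ f
eval σ τ (neg e)     = - eval σ τ e
eval σ τ (app g e f) = g (eval σ τ e) (eval σ τ f)

Update : ℕ → Set
Update d = Fin d → Expr d

subst : ∀ {d} → Expr d → Update d → Expr d
subst (var i)     b = b i
subst (tv k)      b = tv k
subst (con c)     b = con c
subst (add e f)   b = add (subst e b) (subst f b)
subst (mul e f)   b = mul (subst e b) (subst f b)
subst (neg e)     b = neg (subst e b)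
subst (app g e f) b = app g (subst e b) (subst f b)

sq : ∀ {d} → Update d → Update d
sq a i = subst (a i) a

-- An atom  t > 0  is represented by its expression t.
-- Atoms of the form s ≥ u are represented (over ℤ, exactly) by s - u + 1 > 0,
-- and the negation of t > 0 (i.e. t ≤ 0) by -t + 1 > 0.
geq : ∀ {d} → Expr d → Expr d → Expr d
geq s u = add (add s (neg u)) (con (+ 1))

negAtom : ∀ {d} → Expr d → Expr d
negAtom t = add (neg t) (con (+ 1))

AtomSet : ℕ → Set₁
AtomSet d = Expr d → Set

Sat : ∀ {d} → (Fin d → ℤ) → (ℕ → ℤ) → AtomSet d → Set
Sat σ τ P = ∀ e → P e → + 0 < eval σ τ e

Rest : ∀ {d} → List (Expr d) → Expr d → AtomSet d
Rest φ ξ e = (e ∈ φ) × (e ≢ ξ)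

data Kind : Set where
  inc dec ev-dec ev-inc : Kind

-- Premise atoms P (besides the formula φ̌) and conclusion atom Q of
-- encode_α(t > 0, φ̌, a) = (P ∧ φ̌) ⇒ Q.
pre : ∀ {d} → Kind → Expr d → Update d → List (Expr d)
pre inc    t a = t ∷ []
pre dec    t a = subst t a ∷ []
pre ev-dec t a = geq t (subst t a) ∷ []
pre ev-inc t a = geq (subst t a) t ∷ []

post : ∀ {d} → Kind → Expr d → Update d → Expr d
post inc    t a = subst t a
post dec    t a = t
post ev-dec t a = geq (subst t a) (subst t (sq a))
post ev-inc t a = geq (subst t (sq a)) (subst t a)

EncodeValid : ∀ {d} → Kind → Expr d → ((Fin d → ℤ) → (ℕ → ℤ) → Set) → Update d → Set
EncodeValid α ξ φ̌ a =
  ∀ σ τ → Sat σ τ (λ e → e ∈ pre α ξ a) → φ̌ σ τ → + 0 < eval σ τ (post α ξ a)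

Conj : ∀ {d} → AtomSet d → ((Fin d → ℤ) → (ℕ → ℤ) → Set)
Conj P σ τ = Sat σ τ P

-- Atoms of ¬ encode_α(ξ, C, a) where C is a conjunction (set) of atoms:
-- atoms of P, atoms of C, and the negation of Q.
NegEncodeAtoms : ∀ {d} → Kind → Expr d → AtomSet d → Update d → AtomSet d
NegEncodeAtoms α ξ C a e = (e ∈ pre α ξ a) ⊎ (C e ⊎ (e ≡ negAtom (post α ξ a)))

Unsat : ∀ {d} → AtomSet d → Set
Unsat P = ∀ σ τ → Sat σ τ P → ⊥

data Result (d : ℕ) : Set where
  bot  : Result d
  conj : List (Expr d) → Result d

-- The formula returned when the validity condition holds;
-- cf is the closed form a^{n-1}(x) (parameterized by n = tv 0).
success : ∀ {d} → Kind → Expr d → Update d → Update d → Result d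
success inc    t a cf = conj (t ∷ [])
success dec    t a cf = conj (subst t cf ∷ [])
success ev-dec t a cf = conj (t ∷ subst t cf ∷ [])
success ev-inc t a cf = conj (t ∷ geq (subst t a) t ∷ [])

-- accel_α(ξ, φ̌, a): the validity of encode_α is in general undecidable,
-- so the case distinction is made on a supplied decision of it.
accel : ∀ {d} (α : Kind) (ξ : Expr d) (φ̌ : (Fin d → ℤ) → (ℕ → ℤ) → Set)
        (a cf : Update d) → Dec (EncodeValid α ξ φ̌ a) → Result d
accel α ξ φ̌ a cf (yes _) = success α ξ a cf
accel α ξ φ̌ a cf (no _)  = bot

-- If the negated encoding is refuted by a core U, then any formula implying the atoms of
-- φ \ {ξ} that lie in U already makes the encoding valid: a countermodel would satisfy
-- all of U.  Applied once with U itself and once with the whole negated encoding (a core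
-- of itself), this shows that φ̌ and φ \ {ξ} make encode_α valid simultaneously, and
-- accel depends only on that validity.
module Submission where

open import Defs
open import Data.Nat using (ℕ; s≤s; z≤n)
open import Data.Integer using (ℤ; _<_; _≤_; +_; -_; _+_; _<?_; +<+)
open import Data.Integer.Properties using (+-mono-≤-<; neg-mono-≤; ≮⇒≥)
open import Data.Fin using (Fin)
open import Data.List using (List)
open import Data.List.Membership.Propositional using (_∈_)
open import Data.Product using (_×_; _,_)
open import Data.Sum using (inj₁; inj₂)
open import Data.Empty using (⊥-elim)
open import Relation.Binary.PropositionalEquality using (_≡_; refl)
open import Relation.Nullary using (Dec; yes; no)

Formula : ℕ → Set₁
Formula d = (Fin d → ℤ) → (ℕ → ℤ) → Set

negAtom-sat : ∀ {d} σ τ (t : Expr d) → eval σ τ t ≤ + 0 → + 0 < eval σ τ (negAtom t)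
negAtom-sat σ τ t t≤0 = +-mono-≤-< (neg-mono-≤ t≤0) (+<+ (s≤s z≤n))

unsatCore⇒encodeValid : ∀ {d} (α : Kind) (ξ : Expr d) (a : Update d) (C P : AtomSet d)
  → (∀ e → P e → NegEncodeAtoms α ξ C a e)
  → Unsat P
  → (φ̌ : Formula d)
  → (∀ σ τ → φ̌ σ τ → Sat σ τ (λ e → C e × P e))
  → EncodeValid α ξ φ̌ a
unsatCore⇒encodeValid α ξ a C P P⊆ P-unsat φ̌ φ̌⇒C∩P σ τ sat-pre φ̌-holds
  with + 0 <? eval σ τ (post α ξ a)
... | yes post-holds = post-holds
... | no post-fails = ⊥-elim (P-unsat σ τ sat-P)
  where
  sat-P : Sat σ τ P
  sat-P e e∈P with P⊆ e e∈P
  ... | inj₁ e∈pre          = sat-pre e e∈pre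
  ... | inj₂ (inj₁ e∈C)     = φ̌⇒C∩P σ τ φ̌-holds e (e∈C , e∈P)
  ... | inj₂ (inj₂ refl)    = negAtom-sat σ τ (post α ξ a) (≮⇒≥ post-fails)

theorem1 : ∀ {d : ℕ} (a cf : Update d) (φ : List (Expr d)) (α : Kind) (ξ : Expr d)
    → ξ ∈ φ
    → Unsat (NegEncodeAtoms α ξ (Rest φ ξ) a)
    → (U : AtomSet d)
    → (∀ e → U e → NegEncodeAtoms α ξ (Rest φ ξ) a e)
    → Unsat U
    → (φ̌ : (Fin d → ℤ) → (ℕ → ℤ) → Set)
    → (∀ σ τ → φ̌ σ τ → Sat σ τ (λ e → Rest φ ξ e × U e))
    → (dec₁ : Dec (EncodeValid α ξ φ̌ a))
    → (dec₂ : Dec (EncodeValid α ξ (Conj (Rest φ ξ)) a))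
    → accel α ξ φ̌ a cf dec₁ ≡ accel α ξ (Conj (Rest φ ξ)) a cf dec₂
theorem1 a cf φ α ξ _ negEncode-unsat U U⊆ U-unsat φ̌ φ̌⇒deps dec₁ dec₂ with dec₁ | dec₂
... | yes _       | yes _       = refl
... | no _        | no _        = refl
... | no ¬valid-φ̌ | yes _       = ⊥-elim (¬valid-φ̌ valid-φ̌)
  where
  valid-φ̌ : EncodeValid α ξ φ̌ a
  valid-φ̌ = unsatCore⇒encodeValid α ξ a (Rest φ ξ) U U⊆ U-unsat φ̌ φ̌⇒deps
... | yes _       | no ¬valid-φ = ⊥-elim (¬valid-φ valid-φ)
  where
  valid-φ : EncodeValid α ξ (Conj (Rest φ ξ)) a
  valid-φ = unsatCore⇒encodeValid α ξ a (Rest φ ξ) (NegEncodeAtoms α ξ (Rest φ ξ) a)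
              (λ _ e∈ → e∈) negEncode-unsat (Conj (Rest φ ξ)) (λ _ _ sat e (e∈C , _) → sat e e∈C)
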